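{- Let $1\le n\le\omega$ and let $A$ be a nontrivial Boolean algebra. If $X\subseteq A$ is a maximal $n$-independent subset of $A$, then the set $Y$ of nonzero elementary products of elements of $X$ is weakly dense in $A$.
   Context: An elementary product of $X$ is an element $\prod_{x\in R}x^{\epsilon_x}$ with $R\subseteq X$ finite and $\epsilon\in{}^R2$, where $a^1=a$, $a^0=-a$. $Y$ is weakly dense in $A$ if $Y\subseteq A\smallsetminus\{0\}$ and for every nonzero $a\in A$ there is $y\in Y$ with $y\le a$ or $y\le-a$. $X\subseteq A$ is $n$-independent ($n<\omega$) if $0\notin X$ and for all nonempty finite $F,G\subseteq X$: $\sum F\neq1$; if $\prod F=0$ then $\prod F'=0$ for some $F'\subseteq F$ with $|F'|\le n$; if $0\neq\prod F\le\sum G$ then $F\cap G\neq\emptyset$. $\omega$-independent means $0\notin X$ and the first and third conditions hold. Maximal means maximal under inclusion among $n$-independent subsets of $A$. -}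

module Defs where

open import Level using (Level; _⊔_; suc)
open import Data.Nat using (ℕ; _≤_)
open import Data.Bool using (Bool; true; false)
open import Data.Product using (_×_; _,_; proj₁; proj₂; ∃; ∃-syntax; Σ-syntax)
open import Data.Sum using (_⊎_)
open import Data.List using (List; []; _∷_; foldr; map; length)
open import Data.List.Relation.Unary.All using (All)
open import Data.List.Relation.Unary.AllPairs using (AllPairs)
import Data.List.Membership.Setoid as SetoidMembership
open import Relation.Nullary using (¬_)
open import Relation.Unary using (Pred)
open import Algebra.Lattice.Bundles using (BooleanAlgebra)

data Index : Set where
  fin : ℕ → Index
  ω   : Index

data OneLeq : Index → Set where
  fin≥1 : ∀ {k} → 1 ≤ k → OneLeq (fin k)
  ω≥1   : OneLeq ω

module _ {c ℓ : Level} (B : BooleanAlgebra c ℓ) where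
  open BooleanAlgebra B renaming (¬_ to -_)
  open SetoidMembership setoid using (_∈_)

  _≤ᴮ_ : Carrier → Carrier → Set ℓ
  a ≤ᴮ b = (a ∧ b) ≈ a

  Nontrivial : Set ℓ
  Nontrivial = ¬ (⊤ ≈ ⊥)

  Σᴮ : List Carrier → Carrier
  Σᴮ = foldr _∨_ ⊥

  Πᴮ : List Carrier → Carrier
  Πᴮ = foldr _∧_ ⊤

  -- finite subsets as lists; F ⊆ S
  _⊆ₗ_ : ∀ {ℓx} → List Carrier → Pred Carrier ℓx → Set (c ⊔ ℓx)
  F ⊆ₗ S = All S F

  NonEmpty : List Carrier → Set
  NonEmpty [] = Data.Empty.⊥ where import Data.Empty
  NonEmpty (_ ∷ _) = Data.Unit.⊤ where import Data.Unit

  -- subset of a finite set, as sets (membership up to ≈)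
  _⊑_ : List Carrier → List Carrier → Set (c ⊔ ℓ)
  F' ⊑ F = All (_∈ F) F'

  Meets : List Carrier → List Carrier → Set (c ⊔ ℓ)
  Meets F G = ∃[ x ] (x ∈ F × x ∈ G)

  Independent : ∀ {ℓx} → Index → Pred Carrier ℓx → Set (c ⊔ ℓ ⊔ ℓx)
  Independent n X =
      ¬ X ⊥
    × (∀ F → NonEmpty F → F ⊆ₗ X → ¬ (Σᴮ F ≈ ⊤))
    × SecondCond n
    × (∀ F G → NonEmpty F → NonEmpty G → F ⊆ₗ X → G ⊆ₗ X →
         ¬ (Πᴮ F ≈ ⊥) → Πᴮ F ≤ᴮ Σᴮ G → Meets F G)
    where
    SecondCond : Index → Set _
    SecondCond (fin k) = ∀ F → NonEmpty F → F ⊆ₗ X → Πᴮ F ≈ ⊥ →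
                           ∃[ F' ] (F' ⊑ F × length F' ≤ k × Πᴮ F' ≈ ⊥)
    SecondCond ω = Level.Lift _ Data.Unit.⊤ where import Data.Unit

  _⊆ᴾ_ : ∀ {ℓx} → Pred Carrier ℓx → Pred Carrier ℓx → Set (c ⊔ ℓx)
  X ⊆ᴾ Z = ∀ x → X x → Z x

  MaximalIndependent : ∀ {ℓx} → Index → Pred Carrier ℓx → Set (c ⊔ ℓ ⊔ suc ℓx)
  MaximalIndependent {ℓx} n X =
    Independent n X × (∀ (Z : Pred Carrier ℓx) → Independent n Z → X ⊆ᴾ Z → Z ⊆ᴾ X)

  power : Carrier → Bool → Carrier
  power a true  = a
  power a false = - a

  -- elementary product of X: ∏_{x∈R} x^{ε_x}, R ⊆ X finite (listed without
  -- repetition), ε : R → 2 (the Bool attached to each element).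
  ElementaryProduct : ∀ {ℓx} → Pred Carrier ℓx → Pred Carrier (c ⊔ ℓ ⊔ ℓx)
  ElementaryProduct X y =
    ∃[ R ] (All (λ p → X (proj₁ p)) R
          × AllPairs (λ p q → ¬ (proj₁ p ≈ proj₁ q)) R
          × y ≈ Πᴮ (map (λ p → power (proj₁ p) (proj₂ p)) R))

  NonzeroElementaryProducts : ∀ {ℓx} → Pred Carrier ℓx → Pred Carrier (c ⊔ ℓ ⊔ ℓx)
  NonzeroElementaryProducts X y = ElementaryProduct X y × ¬ (y ≈ ⊥)

  WeaklyDense : ∀ {ℓy} → Pred Carrier ℓy → Set (c ⊔ ℓ ⊔ ℓy)
  WeaklyDense Y =
      (∀ y → Y y → ¬ (y ≈ ⊥))
    × (∀ a → ¬ (a ≈ ⊥) → ∃[ y ] (Y y × (y ≤ᴮ a ⊎ y ≤ᴮ (- a))))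

module Submission where

-- Let X be maximal n-independent in a nontrivial Boolean algebra B and let
-- a ≠ 0 be "undecided": no nonzero elementary product of X lies below a or
-- below -a.  We show that Z = X ∪ {a} is again n-independent; maximality then
-- puts a into X, so a itself is a nonzero elementary product below a, a
-- contradiction.
--
-- The heart of the argument is `drop-a`: if F, G ⊆ Z are finite, disjoint and
-- ⋀F ≤ ⋁G, then the same holds after deleting a from F and G.  Indeed the
-- remainder y = ⋀F₀ ∧ -⋁G₀ is an elementary product with y ∧ c = 0, where
-- c ∈ {1, a, -a} is the factor contributed by the occurrences of a (c = 0
-- would need a on both sides).  As a is undecided this forces y = 0.  Each
-- independence condition of Z then reduces to the same condition of X.

open import Defs
open import Level using (Level; Lift; lift; _⊔_)
open import Axiom.ExcludedMiddle using (ExcludedMiddle)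
open import Relation.Unary using (Pred)
open import Algebra.Bundles using (CommutativeSemigroup)
open import Algebra.Structures using (IsCommutativeBand)
open import Algebra.Lattice.Bundles using (BooleanAlgebra; Semilattice)
import Algebra.Properties.CommutativeSemigroup as CommutativeSemigroupProperties
import Algebra.Lattice.Properties.BooleanAlgebra as BooleanAlgebraProperties
import Algebra.Lattice.Properties.Lattice as LatticeProperties
open import Data.Bool using (Bool; true; false)
open import Data.Unit using (tt)
import Data.Nat as ℕ
open import Data.Product using (_×_; _,_; proj₁; proj₂; ∃-syntax)
open import Data.Sum using (_⊎_; inj₁; inj₂)
open import Data.List using (List; []; _∷_; _++_; map; foldr; filter; deduplicate; length)
open import Data.List.Relation.Unary.All as All using (All; []; _∷_)
import Data.List.Relation.Unary.All.Properties as AllProperties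
open import Data.List.Relation.Unary.AllPairs using (AllPairs; []; _∷_)
open import Data.List.Relation.Unary.Any using (here; there)
import Data.List.Relation.Unary.AllPairs.Properties as AllPairsProperties
open import Data.List.Relation.Unary.Unique.DecSetoid.Properties using (deduplicate-!)
import Data.List.Membership.Setoid as SetoidMembership
open import Data.List.Membership.Setoid.Properties using (∈-resp-≈)
import Data.Empty as Empty
open import Relation.Nullary using (¬_; yes; no; ¬?)
open import Relation.Nullary.Decidable using (True; toWitness; fromWitness; decidable-stable)
open import Relation.Binary using (Decidable; DecSetoid)
open import Relation.Binary.PropositionalEquality using (_≡_) renaming (refl to ≡-refl)
open import Function using (_∘_; id)

semilattice⇒commutativeSemigroup : ∀ {c ℓ} → Semilattice c ℓ → CommutativeSemigroup c ℓ
semilattice⇒commutativeSemigroup S = record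
  { isCommutativeSemigroup =
      IsCommutativeBand.isCommutativeSemigroup (Semilattice.isSemilattice S) }

module FoldDeduplicate {c ℓ : Level} (S : Semilattice c ℓ)
  (_≟_ : Decidable (Semilattice._≈_ S)) where
  open Semilattice S
  open CommutativeSemigroupProperties (semilattice⇒commutativeSemigroup S)
    using (x∙yz≈y∙xz)
  open import Relation.Binary.Reasoning.Setoid setoid

  fold-filter : ∀ e x ys →
    x ∙ foldr _∙_ e (filter (¬? ∘ (x ≟_)) ys) ≈ x ∙ foldr _∙_ e ys
  fold-filter e x [] = refl
  fold-filter e x (y ∷ ys) with x ≟ y
  ... | yes x≈y = begin
    x ∙ foldr _∙_ e (filter (¬? ∘ (x ≟_)) ys) ≈⟨ fold-filter e x ys ⟩
    x ∙ foldr _∙_ e ys                        ≈⟨ ∙-congʳ (idem x) ⟨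
    (x ∙ x) ∙ foldr _∙_ e ys                  ≈⟨ assoc x x _ ⟩
    x ∙ (x ∙ foldr _∙_ e ys)                  ≈⟨ ∙-congˡ (∙-congʳ x≈y) ⟩
    x ∙ (y ∙ foldr _∙_ e ys)                  ∎
  ... | no _ = begin
    x ∙ (y ∙ foldr _∙_ e (filter (¬? ∘ (x ≟_)) ys)) ≈⟨ x∙yz≈y∙xz x y _ ⟩
    y ∙ (x ∙ foldr _∙_ e (filter (¬? ∘ (x ≟_)) ys)) ≈⟨ ∙-congˡ (fold-filter e x ys) ⟩
    y ∙ (x ∙ foldr _∙_ e ys)                        ≈⟨ x∙yz≈y∙xz y x _ ⟩
    x ∙ (y ∙ foldr _∙_ e ys)                        ∎

  fold-deduplicate : ∀ e xs → foldr _∙_ e (deduplicate _≟_ xs) ≈ foldr _∙_ e xs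
  fold-deduplicate e [] = refl
  fold-deduplicate e (x ∷ xs) =
    trans (fold-filter e x (deduplicate _≟_ xs)) (∙-congˡ (fold-deduplicate e xs))

module Proof (lem : ∀ {p} → ExcludedMiddle p) {c ℓ ℓx : Level} (B : BooleanAlgebra c ℓ)
  (nontrivial : Nontrivial B) (X : Pred (BooleanAlgebra.Carrier B) ℓx) where

  open BooleanAlgebra B renaming (¬_ to -_)
  open BooleanAlgebraProperties B
    using (∧-identityʳ; ∧-identityˡ; ∨-identityʳ; ∨-identityˡ; ∧-zeroʳ; ¬⊥≈⊤; ¬-involutive; deMorgan₂)
  open LatticeProperties lattice using (∧-idem; ∨-idem; ∧-semilattice; ∨-semilattice)
  module ∧-Props = CommutativeSemigroupProperties (semilattice⇒commutativeSemigroup ∧-semilattice)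
  module ∨-Props = CommutativeSemigroupProperties (semilattice⇒commutativeSemigroup ∨-semilattice)
  open SetoidMembership setoid using (_∈_)
  open import Relation.Binary.Reasoning.Setoid setoid

  ⋀ ⋁ : List Carrier → Carrier
  ⋀ = Πᴮ B
  ⋁ = Σᴮ B

  infix 4 _≤_
  _≤_ : Carrier → Carrier → Set ℓ
  _≤_ = _≤ᴮ_ B

  byContradiction : ∀ {p} {P : Set p} → ¬ ¬ P → P
  byContradiction = decidable-stable lem

  _≟_ : Decidable _≈_
  x ≟ y = lem

  disjoint-complement⇒≤ : ∀ y a → y ∧ - a ≈ ⊥ → y ≤ a
  disjoint-complement⇒≤ y a y∧-a≈⊥ = begin
    y ∧ a             ≈⟨ ∨-identityʳ _ ⟨
    y ∧ a ∨ ⊥         ≈⟨ ∨-congˡ y∧-a≈⊥ ⟨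
    y ∧ a ∨ y ∧ - a   ≈⟨ ∧-distribˡ-∨ y a (- a) ⟨
    y ∧ (a ∨ - a)     ≈⟨ ∧-congˡ (∨-complementʳ a) ⟩
    y ∧ ⊤             ≈⟨ ∧-identityʳ y ⟩
    y                 ∎

  disjoint⇒≤-complement : ∀ y a → y ∧ a ≈ ⊥ → y ≤ - a
  disjoint⇒≤-complement y a y∧a≈⊥ =
    disjoint-complement⇒≤ y (- a) (trans (∧-congˡ (¬-involutive a)) y∧a≈⊥)

  ≤⇒disjoint-complement : ∀ {x y} → x ≤ y → x ∧ - y ≈ ⊥
  ≤⇒disjoint-complement {x} {y} x≤y = begin
    x ∧ - y         ≈⟨ ∧-congʳ x≤y ⟨
    (x ∧ y) ∧ - y   ≈⟨ ∧-assoc x y (- y) ⟩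
    x ∧ (y ∧ - y)   ≈⟨ ∧-congˡ (∧-complementʳ y) ⟩
    x ∧ ⊥           ≈⟨ ∧-zeroʳ x ⟩
    ⊥               ∎

  ≤⊥⇒≈⊥ : ∀ {x} → x ≤ ⊥ → x ≈ ⊥
  ≤⊥⇒≈⊥ {x} x≤⊥ = trans (sym x≤⊥) (∧-zeroʳ x)

  x∧-⊥≈x : ∀ x → x ∧ - ⊥ ≈ x
  x∧-⊥≈x x = trans (∧-congˡ ¬⊥≈⊤) (∧-identityʳ x)

  rearrange : ∀ c p d s → (c ∧ p) ∧ - (d ∨ s) ≈ (p ∧ - s) ∧ (c ∧ - d)
  rearrange c p d s = begin
    (c ∧ p) ∧ - (d ∨ s)     ≈⟨ ∧-congˡ (deMorgan₂ d s) ⟩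
    (c ∧ p) ∧ (- d ∧ - s)   ≈⟨ ∧-Props.interchange c p (- d) (- s) ⟩
    (c ∧ - d) ∧ (p ∧ - s)   ≈⟨ ∧-comm _ _ ⟩
    (p ∧ - s) ∧ (c ∧ - d)   ∎

  ⊑-trans : ∀ {F G H} → All (_∈ G) F → All (_∈ H) G → All (_∈ H) F
  ⊑-trans F⊑G G⊑H = All.map (All.lookupₛ setoid (∈-resp-≈ setoid) G⊑H) F⊑G

  ⊑-refl : ∀ F → All (_∈ F) F
  ⊑-refl F = All.tabulateₛ setoid id

  Meets-mono : ∀ {F₀ G₀ F G} → All (_∈ F) F₀ → All (_∈ G) G₀ →
               Meets B F₀ G₀ → Meets B F G
  Meets-mono F₀⊑F G₀⊑G (x , x∈F₀ , x∈G₀) =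
    x , All.lookupₛ setoid (∈-resp-≈ setoid) F₀⊑F x∈F₀ , All.lookupₛ setoid (∈-resp-≈ setoid) G₀⊑G x∈G₀

  literal : Carrier × Bool → Carrier
  literal (x , ε) = power B x ε

  signed : List Carrier → List Carrier → List (Carrier × Bool)
  signed F G = map (_, true) F ++ map (_, false) G

  ⋀-negative : ∀ G → ⋀ (map literal (map (_, false) G)) ≈ - ⋁ G
  ⋀-negative [] = sym ¬⊥≈⊤
  ⋀-negative (x ∷ G) = trans (∧-congˡ (⋀-negative G)) (sym (deMorgan₂ x (⋁ G)))

  ⋀-signed : ∀ F G → ⋀ (map literal (signed F G)) ≈ ⋀ F ∧ - ⋁ G
  ⋀-signed [] G = trans (⋀-negative G) (sym (∧-identityˡ _))
  ⋀-signed (x ∷ F) G = trans (∧-congˡ (⋀-signed F G)) (sym (∧-assoc _ _ _))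

  dedup : List Carrier → List Carrier
  dedup = deduplicate _≟_

  dedup-unique : ∀ F → AllPairs (λ x y → ¬ x ≈ y) (dedup F)
  dedup-unique = deduplicate-! decSetoid
    where
    decSetoid : DecSetoid c ℓ
    decSetoid = record
      { isDecEquivalence = record { isEquivalence = isEquivalence ; _≟_ = _≟_ } }

  signed-elementary : ∀ {F G} → All X F → All X G → ¬ Meets B F G →
                      ElementaryProduct B X (⋀ F ∧ - ⋁ G)
  signed-elementary {F} {G} F⊆X G⊆X F∩G=∅ = signed F′ G′ , generators , distinct , value
    where
    F′ G′ : List Carrier
    F′ = dedup F
    G′ = dedup G
    F′⊑F : All (_∈ F) F′
    F′⊑F = AllProperties.deduplicate⁺ _≟_ (⊑-refl F)
    G′⊑G : All (_∈ G) G′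
    G′⊑G = AllProperties.deduplicate⁺ _≟_ (⊑-refl G)
    generators : All (λ p → X (proj₁ p)) (signed F′ G′)
    generators = AllProperties.++⁺ (AllProperties.map⁺ (AllProperties.deduplicate⁺ _≟_ F⊆X))
                                   (AllProperties.map⁺ (AllProperties.deduplicate⁺ _≟_ G⊆X))
    across : All (λ p → All (λ q → ¬ proj₁ p ≈ proj₁ q)
                            (map (_, false) G′))
                 (map (_, true) F′)
    across = AllProperties.map⁺ (All.map (λ x∈F → AllProperties.map⁺ (All.map
               (λ y∈G x≈y → F∩G=∅ (_ , x∈F , ∈-resp-≈ setoid (sym x≈y) y∈G)) G′⊑G)) F′⊑F)
    distinct : AllPairs (λ p q → ¬ proj₁ p ≈ proj₁ q) (signed F′ G′)
    distinct = AllPairsProperties.++⁺ (AllPairsProperties.map⁺ (dedup-unique F))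
                                      (AllPairsProperties.map⁺ (dedup-unique G)) across
    value : ⋀ F ∧ - ⋁ G ≈ ⋀ (map literal (signed F′ G′))
    value = begin
      ⋀ F ∧ - ⋁ G     ≈⟨ ∧-cong (FoldDeduplicate.fold-deduplicate ∧-semilattice _≟_ ⊤ F)
                              (¬-cong (FoldDeduplicate.fold-deduplicate ∨-semilattice _≟_ ⊥ G)) ⟨
      ⋀ F′ ∧ - ⋁ G′   ≈⟨ ⋀-signed F′ G′ ⟨
      ⋀ (map literal (signed F′ G′)) ∎

  generator-elementary : ∀ {x} → X x → ElementaryProduct B X x
  generator-elementary {x} x∈X = (x , true) ∷ [] , x∈X ∷ [] , [] ∷ [] , sym (∧-identityʳ x)

  -- Extending the independence conditions of X to possibly empty lists; the
  -- empty cases are excluded because B is nontrivial.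
  module Conditions
    (X-join : ∀ F → NonEmpty B F → All X F → ¬ ⋁ F ≈ ⊤)
    (X-meets : ∀ F G → NonEmpty B F → NonEmpty B G → All X F → All X G →
                 ¬ ⋀ F ≈ ⊥ → ⋀ F ≤ ⋁ G → Meets B F G) where

    ⊤≰⋁ : ∀ G → All X G → ¬ ⊤ ≤ ⋁ G
    ⊤≰⋁ [] _ ⊤≤⊥ = nontrivial (≤⊥⇒≈⊥ ⊤≤⊥)
    ⊤≰⋁ G@(_ ∷ _) G⊆X ⊤≤G = X-join G tt G⊆X (trans (sym (∧-identityˡ _)) ⊤≤G)

    meets : ∀ F G → All X F → All X G → ¬ ⋀ F ≈ ⊥ → ⋀ F ≤ ⋁ G → Meets B F G
    meets [] G _ G⊆X _ ⊤≤G = Empty.⊥-elim (⊤≰⋁ G G⊆X ⊤≤G)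
    meets F@(_ ∷ _) [] _ _ F≉⊥ F≤⊥ = Empty.⊥-elim (F≉⊥ (≤⊥⇒≈⊥ F≤⊥))
    meets F@(_ ∷ _) G@(_ ∷ _) = X-meets F G tt tt

  small-zero-subproduct : ∀ k →
    (∀ F → NonEmpty B F → All X F → ⋀ F ≈ ⊥ →
       ∃[ F′ ] (All (_∈ F) F′ × length F′ ℕ.≤ k × ⋀ F′ ≈ ⊥)) →
    ∀ F → All X F → ⋀ F ≈ ⊥ → ∃[ F′ ] (All (_∈ F) F′ × length F′ ℕ.≤ k × ⋀ F′ ≈ ⊥)
  small-zero-subproduct k X-small [] _ ⊤≈⊥ = Empty.⊥-elim (nontrivial ⊤≈⊥)
  small-zero-subproduct k X-small F@(_ ∷ _) = X-small F tt

  Undecided : Carrier → Set (c ⊔ ℓ ⊔ ℓx)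
  Undecided a = ¬ (∃[ y ] (NonzeroElementaryProducts B X y × (y ≤ a ⊎ y ≤ - a)))

  module Adjoin (a : Carrier) (a≉⊥ : ¬ a ≈ ⊥) (undecided : Undecided a) where

    -- Z = X ∪ {a}; membership of a goes through a Boolean so that Z lives at
    -- the same universe level as X.
    Z : Pred Carrier ℓx
    Z y = X y ⊎ Lift ℓx (True (y ≟ a))

    Z-cases : ∀ {y} → Z y → X y ⊎ y ≈ a
    Z-cases (inj₁ y∈X) = inj₁ y∈X
    Z-cases {y} (inj₂ (lift t)) = inj₂ (toWitness {a? = y ≟ a} t)

    a∈Z : Z a
    a∈Z = inj₂ (lift (fromWitness {a? = a ≟ a} refl))

    -- What the occurrences of a contribute to a meet, resp. a join.
    aMeet aJoin : Bool → Carrier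
    aMeet true  = a
    aMeet false = ⊤
    aJoin true  = a
    aJoin false = ⊥

    record Split (F : List Carrier) : Set (c ⊔ ℓ ⊔ ℓx) where
      field
        rest    : List Carrier
        hasA    : Bool
        rest⊆X  : All X rest
        rest⊑F  : All (_∈ F) rest
        ⋀-split : ⋀ F ≈ aMeet hasA ∧ ⋀ rest
        ⋁-split : ⋁ F ≈ aJoin hasA ∨ ⋁ rest
        a∈F     : hasA ≡ true → a ∈ F
    open Split

    a∧aMeet : ∀ b p → a ∧ (aMeet b ∧ p) ≈ a ∧ p
    a∧aMeet true  p = trans (sym (∧-assoc a a p)) (∧-congʳ (∧-idem a))
    a∧aMeet false p = ∧-congˡ (∧-identityˡ p)

    a∨aJoin : ∀ b s → a ∨ (aJoin b ∨ s) ≈ a ∨ s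
    a∨aJoin true  s = trans (sym (∨-assoc a a s)) (∨-congʳ (∨-idem a))
    a∨aJoin false s = ∨-congˡ (∨-identityˡ s)

    split : ∀ F → All Z F → Split F
    split [] [] = record
      { rest = [] ; hasA = false ; rest⊆X = [] ; rest⊑F = []
      ; ⋀-split = sym (∧-identityˡ ⊤) ; ⋁-split = sym (∨-identityˡ ⊥) ; a∈F = λ () }
    split (x ∷ F) (x∈Z ∷ F⊆Z) with Z-cases x∈Z | split F F⊆Z
    ... | inj₁ x∈X | S = record
      { rest = x ∷ rest S ; hasA = hasA S ; rest⊆X = x∈X ∷ rest⊆X S
      ; rest⊑F = here refl ∷ All.map there (rest⊑F S)
      ; ⋀-split = trans (∧-congˡ (⋀-split S)) (∧-Props.x∙yz≈y∙xz _ _ _)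
      ; ⋁-split = trans (∨-congˡ (⋁-split S)) (∨-Props.x∙yz≈y∙xz _ _ _)
      ; a∈F = there ∘ a∈F S }
    ... | inj₂ x≈a | S = record
      { rest = rest S ; hasA = true ; rest⊆X = rest⊆X S
      ; rest⊑F = All.map there (rest⊑F S)
      ; ⋀-split = trans (∧-cong x≈a (⋀-split S)) (a∧aMeet (hasA S) _)
      ; ⋁-split = trans (∨-cong x≈a (⋁-split S)) (a∨aJoin (hasA S) _)
      ; a∈F = λ _ → here (sym x≈a) }

    -- A nonzero elementary product y can only vanish against the factor
    -- aMeet bF ∧ -aJoin bG if that factor is a ∧ -a: otherwise it is 1, a or
    -- -a, and y would be 0 or lie below -a or a.
    a-on-both-sides : ∀ bF bG {y} → ElementaryProduct B X y → ¬ y ≈ ⊥ →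
                      y ∧ (aMeet bF ∧ - aJoin bG) ≈ ⊥ → bF ≡ true × bG ≡ true
    a-on-both-sides true true _ _ _ = ≡-refl , ≡-refl
    a-on-both-sides false false {y} _ y≉⊥ y∧1≈⊥ =
      Empty.⊥-elim (y≉⊥ (trans (sym (trans (∧-congˡ (x∧-⊥≈x ⊤)) (∧-identityʳ y))) y∧1≈⊥))
    a-on-both-sides true false {y} y-elem y≉⊥ y∧a≈⊥ =
      Empty.⊥-elim (undecided (y , (y-elem , y≉⊥) ,
        inj₂ (disjoint⇒≤-complement y a (trans (∧-congˡ (sym (x∧-⊥≈x a))) y∧a≈⊥))))
    a-on-both-sides false true {y} y-elem y≉⊥ y∧-a≈⊥ =
      Empty.⊥-elim (undecided (y , (y-elem , y≉⊥) ,
        inj₁ (disjoint-complement⇒≤ y a (trans (∧-congˡ (sym (∧-identityˡ (- a)))) y∧-a≈⊥))))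

    drop-a : ∀ {F G} (SF : Split F) (SG : Split G) → ¬ Meets B F G →
             ⋀ F ≤ ⋁ G → ⋀ (rest SF) ≤ ⋁ (rest SG)
    drop-a {F} {G} SF SG F∩G=∅ F≤G =
      disjoint-complement⇒≤ _ _ (byContradiction remainder-vanishes)
      where
      remainder : Carrier
      remainder = ⋀ (rest SF) ∧ - ⋁ (rest SG)
      remainder-elementary : ElementaryProduct B X remainder
      remainder-elementary = signed-elementary (rest⊆X SF) (rest⊆X SG)
        (F∩G=∅ ∘ Meets-mono (rest⊑F SF) (rest⊑F SG))
      residue : remainder ∧ (aMeet (hasA SF) ∧ - aJoin (hasA SG)) ≈ ⊥
      residue = begin
        remainder ∧ (aMeet (hasA SF) ∧ - aJoin (hasA SG))
          ≈⟨ rearrange _ _ _ _ ⟨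
        (aMeet (hasA SF) ∧ ⋀ (rest SF)) ∧ - (aJoin (hasA SG) ∨ ⋁ (rest SG))
          ≈⟨ ∧-cong (⋀-split SF) (¬-cong (⋁-split SG)) ⟨
        ⋀ F ∧ - ⋁ G
          ≈⟨ ≤⇒disjoint-complement F≤G ⟩
        ⊥ ∎
      remainder-vanishes : ¬ ¬ remainder ≈ ⊥
      remainder-vanishes remainder≉⊥ with a-on-both-sides (hasA SF) (hasA SG)
                                            remainder-elementary remainder≉⊥ residue
      ... | a-in-F , a-in-G = F∩G=∅ (a , a∈F SF a-in-F , a∈F SG a-in-G)

    ⊥∉Z : ¬ X ⊥ → ¬ Z ⊥
    ⊥∉Z ⊥∉X ⊥∈Z with Z-cases ⊥∈Z
    ... | inj₁ ⊥∈X = ⊥∉X ⊥∈X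
    ... | inj₂ ⊥≈a = a≉⊥ (sym ⊥≈a)

    -- Second condition: a vanishing ⋀F over Z has one over X, hence a small
    -- vanishing subproduct.
    Z-small : ∀ k →
      (∀ F → NonEmpty B F → All X F → ⋀ F ≈ ⊥ →
         ∃[ F′ ] (All (_∈ F) F′ × length F′ ℕ.≤ k × ⋀ F′ ≈ ⊥)) →
      ∀ F → NonEmpty B F → All Z F → ⋀ F ≈ ⊥ →
         ∃[ F′ ] (All (_∈ F) F′ × length F′ ℕ.≤ k × ⋀ F′ ≈ ⊥)
    Z-small k X-small F _ F⊆Z F≈⊥ =
      widen (small-zero-subproduct k X-small (rest S) (rest⊆X S) (≤⊥⇒≈⊥ rest≤⊥))
      where
      S : Split F
      S = split F F⊆Z
      rest≤⊥ : ⋀ (rest S) ≤ ⊥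
      rest≤⊥ = drop-a S (split [] []) (λ { (_ , _ , ()) }) (trans (∧-zeroʳ _) (sym F≈⊥))
      widen : ∃[ F′ ] (All (_∈ rest S) F′ × length F′ ℕ.≤ k × ⋀ F′ ≈ ⊥) →
              ∃[ F′ ] (All (_∈ F) F′ × length F′ ℕ.≤ k × ⋀ F′ ≈ ⊥)
      widen (F′ , F′⊑rest , small , F′≈⊥) = F′ , ⊑-trans F′⊑rest (rest⊑F S) , small , F′≈⊥

    module _
      (X-join : ∀ F → NonEmpty B F → All X F → ¬ ⋁ F ≈ ⊤)
      (X-meets : ∀ F G → NonEmpty B F → NonEmpty B G → All X F → All X G →
                   ¬ ⋀ F ≈ ⊥ → ⋀ F ≤ ⋁ G → Meets B F G) where
      open Conditions X-join X-meets

      -- First condition: ⋁F = 1 over Z would give ⊤ ≤ ⋁ over X.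
      Z-join : ∀ F → NonEmpty B F → All Z F → ¬ ⋁ F ≈ ⊤
      Z-join F _ F⊆Z F≈⊤ =
        ⊤≰⋁ (rest S) (rest⊆X S) (drop-a (split [] []) S (λ { (_ , () , _) }) ⊤≤F)
        where
        S : Split F
        S = split F F⊆Z
        ⊤≤F : ⋀ [] ≤ ⋁ F
        ⊤≤F = trans (∧-identityˡ _) F≈⊤

      -- Third condition: for disjoint F, G the inequality passes to X.
      Z-meets : ∀ F G → NonEmpty B F → NonEmpty B G → All Z F → All Z G →
                ¬ ⋀ F ≈ ⊥ → ⋀ F ≤ ⋁ G → Meets B F G
      Z-meets F G _ _ F⊆Z G⊆Z F≉⊥ F≤G = byContradiction λ F∩G=∅ →
        F∩G=∅ (Meets-mono (rest⊑F SF) (rest⊑F SG)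
          (meets (rest SF) (rest SG) (rest⊆X SF) (rest⊆X SG) rest≉⊥ (drop-a SF SG F∩G=∅ F≤G)))
        where
        SF : Split F
        SF = split F F⊆Z
        SG : Split G
        SG = split G G⊆Z
        rest≉⊥ : ¬ ⋀ (rest SF) ≈ ⊥
        rest≉⊥ rest≈⊥ = F≉⊥ (trans (⋀-split SF) (trans (∧-congˡ rest≈⊥) (∧-zeroʳ _)))

    Z-independent : ∀ n → Independent B n X → Independent B n Z
    Z-independent (fin k) (⊥∉X , X-join , X-small , X-meets) =
      ⊥∉Z ⊥∉X , Z-join X-join X-meets , Z-small k X-small , Z-meets X-join X-meets
    Z-independent ω (⊥∉X , X-join , _ , X-meets) =
      ⊥∉Z ⊥∉X , Z-join X-join X-meets , lift tt , Z-meets X-join X-meets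

  -- By maximality an undecided a ≠ 0 would belong to X, and then decide itself.
  weakly-dense : ∀ n → MaximalIndependent B n X → WeaklyDense B (NonzeroElementaryProducts B X)
  weakly-dense n (X-independent , X-maximal) = (λ _ → proj₂) , λ a a≉⊥ →
    byContradiction λ undecided →
      let open Adjoin a a≉⊥ undecided
          a∈X = X-maximal Z (Z-independent n X-independent) (λ _ → inj₁) a a∈Z
      in  undecided (a , (generator-elementary a∈X , a≉⊥) , inj₁ (∧-idem a))

mainTheorem16 : (lem : ∀ {p} → ExcludedMiddle p)
    → {c ℓ ℓx : Level} (B : BooleanAlgebra c ℓ) (n : Index) → OneLeq n
    → Nontrivial B
    → (X : Pred (BooleanAlgebra.Carrier B) ℓx)
    → MaximalIndependent B n X
    → WeaklyDense B (NonzeroElementaryProducts B X)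
mainTheorem16 lem B n _ nontrivial X maximal = Proof.weakly-dense lem B nontrivial X n maximal
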